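{- Let $R$ be a commutative ring and $h=(h_n)_{n>0}$ a sequence in $R$. Let $a_0\ge 0$ be either an integer or a half-integer (an element of $\mathbb{Z}+\tfrac12$). Define $c_{\min}=1,\ d_{\min}=0$ if $a_0$ is an integer, and $c_{\min}=\tfrac32,\ d_{\min}=\tfrac12$ if $a_0$ is a half-integer. Suppose that $h_{c_{\min}+d_{\min}}h_{c_{\min}-d_{\min}}$ is not a zero-divisor in $R$, and that $h$ satisfies $E(a,b,c_{\min},d_{\min})$ for all $a,b$ with $a_0\ge a>b>c_{\min}$. Then $h$ satisfies $E(a,b,c,d)$ for all $a,b,c,d$ with $a_0\ge a>b>c>d\ge 0$. Here all parameters $a,b,c,d$ range over $\mathbb{Z}$ if $a_0\in\mathbb{Z}$ and over $\mathbb{Z}+\tfrac12$ if $a_0\in\mathbb{Z}+\tfrac12$.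
   Context: For a sequence $h=(h_n)_{n>0}$ in a commutative ring and parameters $a,b,c,d$ that are either all integers or all half-integers (so that all the indices below are integers), the elliptic relation $E(a,b,c,d)$ is the identity $$h_{a+b}h_{a-b}h_{c+d}h_{c-d}=h_{a+c}h_{a-c}h_{b+d}h_{b-d}-h_{b+c}h_{b-c}h_{a+d}h_{a-d}.$$ (For $a>b>c>d\ge0$ all indices occurring are positive.) -}

module Defs where

open import Level using (Level)
open import Data.Nat using (ℕ; zero; suc; _∸_) renaming (_+_ to _+ℕ_)
open import Algebra.Bundles using (CommutativeRing)

data Parity : Set where
  integral     : Parity
  halfIntegral : Parity

-- Encoding: a parameter x with parity p is represented by a natural
-- number x' with x = x' (integral case) or x = x' + 1/2 (half-integral
-- case).  Then for x ≥ y:  x + y = x' + y' + shift p  and  x - y = x' ∸ y'.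
shift : Parity → ℕ
shift integral     = 0
shift halfIntegral = 1

module _ {c ℓ : Level} (R : CommutativeRing c ℓ) where
  open CommutativeRing R using (Carrier; _≈_; _*_; _-_; 0#)

  NonZeroDivisor : Carrier → Set (c Level.⊔ ℓ)
  NonZeroDivisor r = ∀ x → x * r ≈ 0# → x ≈ 0#

  -- The elliptic relation E(a,b,c,d) for the sequence h (h 0 is never used
  -- when a > b > c > d ≥ 0), with parameters encoded as above.
  Elliptic : Parity → (ℕ → Carrier) → ℕ → ℕ → ℕ → ℕ → Set ℓ
  Elliptic p h a b c d =
    h (a +ℕ b +ℕ s) * h (a ∸ b) * h (c +ℕ d +ℕ s) * h (c ∸ d)
      ≈ h (a +ℕ c +ℕ s) * h (a ∸ c) * h (b +ℕ d +ℕ s) * h (b ∸ d)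
        - h (b +ℕ c +ℕ s) * h (b ∸ c) * h (a +ℕ d +ℕ s) * h (a ∸ d)
    where s = shift p

{-# OPTIONS --safe #-}
module Submission where

-- Write [x,y] = h(x+y) h(x-y) and t = [c_min,d_min].  The relation E(x,y,c_min,d_min)
-- says that t [x,y] is the 2×2 determinant of the plane vectors ([x,c_min],[x,d_min])
-- and ([y,c_min],[y,d_min]); sending c_min to (0,t) and d_min to (-t,0) makes this hold
-- for every pair x > y.  Multiplied by t², E(a,b,c,d) is then the three-term Plücker
-- relation between the 2×2 minors of four plane vectors, and t² is not a zero-divisor.

open import Defs
open import Level using (Level)
open import Data.Nat using (ℕ; zero; suc; _∸_; _≤_; _<_; z≤n; s≤s)
open import Data.Nat.Properties using (<-trans; <⇒≤; ≤-trans)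
open import Data.Product using (_×_; _,_; proj₁; proj₂)
open import Algebra.Bundles using (CommutativeRing)

module CommutativeRingProperties {c ℓ : Level} (R : CommutativeRing c ℓ) where
  open CommutativeRing R
  open import Algebra.Properties.Ring ring
    using (-0#≈0#; -‿involutive; -‿+-comm; ⁻¹-anti-homo‿-; -‿distribˡ-*;
           x[y-z]≈xy-xz; [y-z]x≈yx-zx; x∙y⁻¹≈ε⇒x≈y; x≈y⇒x∙y⁻¹≈ε)
  open import Algebra.Solver.Ring.NaturalCoefficients.Default commutativeSemiring
  open import Relation.Binary.Reasoning.Setoid setoid

  sub-cong : ∀ {x y z w} → x ≈ y → z ≈ w → x - z ≈ y - w
  sub-cong x≈y z≈w = +-cong x≈y (-‿cong z≈w)

  [x-y]-[z-w]≈[x+w]-[y+z] : ∀ x y z w → (x - y) - (z - w) ≈ (x + w) - (y + z)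
  [x-y]-[z-w]≈[x+w]-[y+z] x y z w = begin
    (x - y) - (z - w)      ≈⟨ +-congˡ (⁻¹-anti-homo‿- z w) ⟩
    (x - y) + (w - z)      ≈⟨ solve 4 (λ x y′ z′ w → (x :+ y′) :+ (w :+ z′) := (x :+ w) :+ (y′ :+ z′))
                                      refl x (- y) (- z) w ⟩
    (x + w) + (- y + - z)  ≈⟨ +-congˡ (-‿+-comm y z) ⟩
    (x + w) - (y + z)      ∎

  x+w≈z+y⇒x-y≈z-w : ∀ {x y z w} → x + w ≈ z + y → x - y ≈ z - w
  x+w≈z+y⇒x-y≈z-w {x} {y} {z} {w} x+w≈z+y = x∙y⁻¹≈ε⇒x≈y (x - y) (z - w) (begin
    (x - y) - (z - w)  ≈⟨ [x-y]-[z-w]≈[x+w]-[y+z] x y z w ⟩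
    (x + w) - (y + z)  ≈⟨ x≈y⇒x∙y⁻¹≈ε (trans x+w≈z+y (+-comm z y)) ⟩
    0#                 ∎)

  [x-y][z-w]≈[xz+yw]-[xw+yz] : ∀ x y z w → (x - y) * (z - w) ≈ (x * z + y * w) - (x * w + y * z)
  [x-y][z-w]≈[xz+yw]-[xw+yz] x y z w = begin
    (x - y) * (z - w)                  ≈⟨ [y-z]x≈yx-zx (z - w) x y ⟩
    x * (z - w) - y * (z - w)          ≈⟨ sub-cong (x[y-z]≈xy-xz x z w) (x[y-z]≈xy-xz y z w) ⟩
    (x * z - x * w) - (y * z - y * w)  ≈⟨ [x-y]-[z-w]≈[x+w]-[y+z] _ _ _ _ ⟩
    (x * z + y * w) - (x * w + y * z)  ∎

  *-nonZeroDivisor : ∀ {r s} → NonZeroDivisor R r → NonZeroDivisor R s → NonZeroDivisor R (r * s)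
  *-nonZeroDivisor {r} {s} r-regular s-regular x x[rs]≈0 =
    r-regular x (s-regular (x * r) (trans (*-assoc x r s) x[rs]≈0))

  nonZeroDivisor-cancelʳ : ∀ {t x y} → NonZeroDivisor R t → x * t ≈ y * t → x ≈ y
  nonZeroDivisor-cancelʳ {t} {x} {y} t-regular xt≈yt = x∙y⁻¹≈ε⇒x≈y x y (t-regular (x - y) (begin
    (x - y) * t    ≈⟨ [y-z]x≈yx-zx t x y ⟩
    x * t - y * t  ≈⟨ x≈y⇒x∙y⁻¹≈ε xt≈yt ⟩
    0#             ∎))

  Vector : Set c
  Vector = Carrier × Carrier

  det : Vector → Vector → Carrier
  det (u₁ , u₂) (v₁ , v₂) = u₁ * v₂ - v₁ * u₂

  det-[0,t] : ∀ u t → det u (0# , t) ≈ proj₁ u * t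
  det-[0,t] (u₁ , u₂) t = begin
    u₁ * t - 0# * u₂  ≈⟨ +-congˡ (-‿cong (zeroˡ u₂)) ⟩
    u₁ * t - 0#       ≈⟨ +-congˡ -0#≈0# ⟩
    u₁ * t + 0#       ≈⟨ +-identityʳ (u₁ * t) ⟩
    u₁ * t            ∎

  det-[-t,0] : ∀ u t → det u (- t , 0#) ≈ proj₂ u * t
  det-[-t,0] (u₁ , u₂) t = begin
    u₁ * 0# - (- t) * u₂    ≈⟨ +-cong (zeroʳ u₁) (-‿cong (sym (-‿distribˡ-* t u₂))) ⟩
    0# - (- (t * u₂))       ≈⟨ +-identityˡ _ ⟩
    - (- (t * u₂))          ≈⟨ -‿involutive (t * u₂) ⟩
    t * u₂                  ≈⟨ *-comm t u₂ ⟩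
    u₂ * t                  ∎

  -- The natural-coefficient solver cannot cancel additive inverses, so both sides are
  -- first written as a difference P - N of sums of monomials and compared via P + N′ ≈ P′ + N.
  det-plücker : ∀ u v w z → det u v * det w z ≈ det u w * det v z - det v w * det u z
  det-plücker (u₁ , u₂) (v₁ , v₂) (w₁ , w₂) (z₁ , z₂) = begin
    det u v * det w z
      ≈⟨ [x-y][z-w]≈[xz+yw]-[xw+yz] _ _ _ _ ⟩
    (u₁ * v₂ * (w₁ * z₂) + v₁ * u₂ * (z₁ * w₂)) - (u₁ * v₂ * (z₁ * w₂) + v₁ * u₂ * (w₁ * z₂))
      ≈⟨ x+w≈z+y⇒x-y≈z-w (solve 8 (λ u₁ u₂ v₁ v₂ w₁ w₂ z₁ z₂ →
             (u₁ :* v₂ :* (w₁ :* z₂) :+ v₁ :* u₂ :* (z₁ :* w₂))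
               :+ ((u₁ :* w₂ :* (z₁ :* v₂) :+ w₁ :* u₂ :* (v₁ :* z₂))
                   :+ (v₁ :* w₂ :* (u₁ :* z₂) :+ w₁ :* v₂ :* (z₁ :* u₂)))
             := ((u₁ :* w₂ :* (v₁ :* z₂) :+ w₁ :* u₂ :* (z₁ :* v₂))
                   :+ (v₁ :* w₂ :* (z₁ :* u₂) :+ w₁ :* v₂ :* (u₁ :* z₂)))
               :+ (u₁ :* v₂ :* (z₁ :* w₂) :+ v₁ :* u₂ :* (w₁ :* z₂)))
           refl u₁ u₂ v₁ v₂ w₁ w₂ z₁ z₂) ⟩
    ((u₁ * w₂ * (v₁ * z₂) + w₁ * u₂ * (z₁ * v₂)) + (v₁ * w₂ * (z₁ * u₂) + w₁ * v₂ * (u₁ * z₂)))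
      - ((u₁ * w₂ * (z₁ * v₂) + w₁ * u₂ * (v₁ * z₂)) + (v₁ * w₂ * (u₁ * z₂) + w₁ * v₂ * (z₁ * u₂)))
      ≈⟨ [x-y]-[z-w]≈[x+w]-[y+z] _ _ _ _ ⟨
    ((u₁ * w₂ * (v₁ * z₂) + w₁ * u₂ * (z₁ * v₂)) - (u₁ * w₂ * (z₁ * v₂) + w₁ * u₂ * (v₁ * z₂)))
      - ((v₁ * w₂ * (u₁ * z₂) + w₁ * v₂ * (z₁ * u₂)) - (v₁ * w₂ * (z₁ * u₂) + w₁ * v₂ * (u₁ * z₂)))
      ≈⟨ sub-cong ([x-y][z-w]≈[xz+yw]-[xw+yz] _ _ _ _) ([x-y][z-w]≈[xz+yw]-[xw+yz] _ _ _ _) ⟨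
    det u w * det v z - det v w * det u z
      ∎
    where
    u = (u₁ , u₂); v = (v₁ , v₂); w = (w₁ , w₂); z = (z₁ , z₂)

open import Data.Nat using (_+_)

module EllipticSequence {c ℓ : Level} (R : CommutativeRing c ℓ) (p : Parity) (h : ℕ → CommutativeRing.Carrier R) where
  open CommutativeRing R using (Carrier; _≈_; _*_; _-_; -_; 0#; sym; trans; *-assoc; *-cong; *-commutativeSemigroup)
  open CommutativeRingProperties R
  open import Algebra.Properties.CommutativeSemigroup *-commutativeSemigroup using (interchange)
  open import Algebra.Properties.Ring (CommutativeRing.ring R) using ([y-z]x≈yx-zx)
  open import Relation.Binary.Reasoning.Setoid (CommutativeRing.setoid R)

  bracket : ℕ → ℕ → Carrier
  bracket x y = h (x + y + shift p) * h (x ∸ y)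

  BracketRelation : ℕ → ℕ → ℕ → ℕ → Set ℓ
  BracketRelation a b c d = bracket a b * bracket c d ≈ bracket a c * bracket b d - bracket b c * bracket a d

  Elliptic⇒BracketRelation : ∀ a b c d → Elliptic R p h a b c d → BracketRelation a b c d
  Elliptic⇒BracketRelation a b c d e = trans (sym (*-assoc _ _ _)) (trans e (sub-cong (*-assoc _ _ _) (*-assoc _ _ _)))

  BracketRelation⇒Elliptic : ∀ a b c d → BracketRelation a b c d → Elliptic R p h a b c d
  BracketRelation⇒Elliptic a b c d e = trans (*-assoc _ _ _) (trans e (sub-cong (sym (*-assoc _ _ _)) (sym (*-assoc _ _ _))))

  bracket₁₀ : Carrier
  bracket₁₀ = bracket 1 0

  point : ℕ → Vector
  point zero            = - bracket₁₀ , 0#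
  point (suc zero)      = 0# , bracket₁₀
  point n@(suc (suc _)) = bracket n 1 , bracket n 0

  module _ (a₀ : ℕ) (E[a,b,1,0] : ∀ a b → a ≤ a₀ → b < a → 1 < b → Elliptic R p h a b 1 0) where

    bracket≈det : ∀ {x y} → x ≤ a₀ → y < x → bracket x y * bracket₁₀ ≈ det (point x) (point y)
    bracket≈det {suc zero}        {zero}        _    _        = sym (det-[-t,0] (point 1) bracket₁₀)
    bracket≈det {suc zero}        {suc _}       _    (s≤s ())
    bracket≈det {x@(suc (suc _))} {zero}        _    _        = sym (det-[-t,0] (point x) bracket₁₀)
    bracket≈det {x@(suc (suc _))} {suc zero}    _    _        = sym (det-[0,t] (point x) bracket₁₀)
    bracket≈det {x@(suc (suc _))} {y@(suc (suc _))} x≤a₀ y<x =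
      Elliptic⇒BracketRelation x y 1 0 (E[a,b,1,0] x y x≤a₀ y<x (s≤s (s≤s z≤n)))

    bracketRelation : NonZeroDivisor R bracket₁₀ → ∀ {a b c d} → a ≤ a₀ → b < a → c < b → d < c → BracketRelation a b c d
    bracketRelation bracket₁₀-regular {a} {b} {c} {d} a≤a₀ b<a c<b d<c =
      nonZeroDivisor-cancelʳ (*-nonZeroDivisor bracket₁₀-regular bracket₁₀-regular) (begin
        bracket a b * bracket c d * (bracket₁₀ * bracket₁₀)
          ≈⟨ interchange _ _ _ _ ⟩
        bracket a b * bracket₁₀ * (bracket c d * bracket₁₀)
          ≈⟨ *-cong (bracket≈det a≤a₀ b<a) (bracket≈det c≤a₀ d<c) ⟩
        det (point a) (point b) * det (point c) (point d)
          ≈⟨ det-plücker _ _ _ _ ⟩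
        det (point a) (point c) * det (point b) (point d) - det (point b) (point c) * det (point a) (point d)
          ≈⟨ sub-cong (*-cong (bracket≈det a≤a₀ c<a) (bracket≈det b≤a₀ d<b))
                      (*-cong (bracket≈det b≤a₀ c<b) (bracket≈det a≤a₀ d<a)) ⟨
        bracket a c * bracket₁₀ * (bracket b d * bracket₁₀) - bracket b c * bracket₁₀ * (bracket a d * bracket₁₀)
          ≈⟨ sub-cong (interchange _ _ _ _) (interchange _ _ _ _) ⟨
        bracket a c * bracket b d * (bracket₁₀ * bracket₁₀) - bracket b c * bracket a d * (bracket₁₀ * bracket₁₀)
          ≈⟨ [y-z]x≈yx-zx _ _ _ ⟨
        (bracket a c * bracket b d - bracket b c * bracket a d) * (bracket₁₀ * bracket₁₀)
          ∎)
      where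
      c<a = <-trans c<b b<a
      d<b = <-trans d<c c<b
      d<a = <-trans d<b b<a
      b≤a₀ = ≤-trans (<⇒≤ b<a) a≤a₀
      c≤a₀ = ≤-trans (<⇒≤ c<a) a≤a₀

lemma2p1 : {c ℓ : Level} (R : CommutativeRing c ℓ) (p : Parity) (h : ℕ → CommutativeRing.Carrier R) (a₀ : ℕ) →
    NonZeroDivisor R (CommutativeRing._*_ R (h (1 + 0 + shift p)) (h 1)) →
    (∀ a b → a ≤ a₀ → b < a → 1 < b → Elliptic R p h a b 1 0) →
    ∀ a b c d → a ≤ a₀ → b < a → c < b → d < c → Elliptic R p h a b c d
lemma2p1 R p h a₀ bracket₁₀-regular E[a,b,1,0] a b c d a≤a₀ b<a c<b d<c =
  BracketRelation⇒Elliptic a b c d (bracketRelation a₀ E[a,b,1,0] bracket₁₀-regular a≤a₀ b<a c<b d<c)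
  where open EllipticSequence R p h
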